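{- For any $k\ge2$ and $0\le a\le k-1$, the lower-triangular array $D^{k,a}$ whose $(n,m)$-entry is $D^{k,a}_{n,m}$ ($0\le m\le n$) equals the proper Riordan array $\mathcal R(d(t),h(t))$ with $d(t)=C_k(t)^{a+1}$ and $h(t)=t\,C_k(t)^k$.
   Context: For $k\ge2$ and $a\ge0$, $D^{k,a}_{n,m}$ is the number of integer lattice paths from $(0,0)$ to $(kn,km)$ using steps $U=(1,1)$ and $(1,1-k)$ that stay weakly above the line $y=-a$. $C_k(t)=\sum_{n\ge0}\frac{1}{kn+1}\binom{kn+1}{n}t^n$ is the generating function of the $k$-Catalan numbers; it satisfies $C_k(t)=1+t\,C_k(t)^k$. The proper Riordan array $\mathcal R(d(t),h(t))$ is the lower-triangular array whose $(i,j)$-entry is $[t^i]\,d(t)h(t)^j$. -}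

module Defs where

open import Data.Nat using (ℕ; zero; suc; _+_; _*_; _∸_)
open import Data.Nat.Combinatorics using (_C_)
open import Data.Nat.DivMod using (_/_)
open import Data.Integer as ℤ using (ℤ; +_; -_)
open import Data.Bool using (Bool; true; false; _∧_)
open import Data.List using (List; []; _∷_; map; length; filterᵇ; upTo; concatMap)
open import Relation.Nullary.Decidable using (⌊_⌋)
open import Data.Nat.ListAction using (sum)

-- U = (1,1),  Dn = (1,1-k)
data Step : Set where
  U Dn : Step

δ : ℕ → Step → ℤ
δ k U  = + 1
δ k Dn = + 1 ℤ.- + k

-- all step sequences of length L (i.e. all paths with L steps, x-coordinate L at the end)
allSeqs : ℕ → List (List Step)
allSeqs zero    = [] ∷ []
allSeqs (suc L) = concatMap (λ s → map (s ∷_) (allSeqs L)) (U ∷ Dn ∷ [])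

goodFrom : ℕ → ℕ → ℤ → ℤ → List Step → Bool
goodFrom k a y tgt []       = ⌊ y ℤ.≟ tgt ⌋
goodFrom k a y tgt (s ∷ ss) =
  ⌊ (- (+ a)) ℤ.≤? (y ℤ.+ δ k s) ⌋ ∧ goodFrom k a (y ℤ.+ δ k s) tgt ss

-- D^{k,a}_{n,m}: number of paths from (0,0) to (kn,km) with steps U, Dn
-- staying weakly above y = -a  (the start (0,0) is above -a since a ≥ 0).
Dpaths : ℕ → ℕ → ℕ → ℕ → ℕ
Dpaths k a n m = length (filterᵇ (goodFrom k a (+ 0) (+ (k * m))) (allSeqs (k * n)))

Series : Set
Series = ℕ → ℕ

_⊛_ : Series → Series → Series
(f ⊛ g) n = sum (map (λ i → f i * g (n ∸ i)) (upTo (suc n)))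

one : Series
one zero    = 1
one (suc _) = 0

_^ˢ_ : Series → ℕ → Series
f ^ˢ zero  = one
f ^ˢ suc j = f ⊛ (f ^ˢ j)

tmul : Series → Series
tmul f zero    = 0
tmul f (suc n) = f n

Ck : ℕ → Series
Ck k n = ((suc (k * n)) C n) / suc (k * n)

riordan : Series → Series → ℕ → ℕ → ℕ
riordan d h i j = (d ⊛ (h ^ˢ j)) i

module Submission where

open import Defs
open import Data.Nat
open import Data.Nat.Properties
open import Data.Nat.Combinatorics using (_C_; nCk+nC[k+1]≡[n+1]C[k+1]; nC1≡n)
open import Data.Nat.DivMod using (_/_; m*n/n≡m)
open import Data.Nat.Induction using (<-rec)
open import Data.Nat.ListAction using (sum)
open import Data.Nat.Solver using (module +-*-Solver)
open import Data.Integer as ℤ using (ℤ; _⊖_; -_)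
import Data.Integer.Properties as ℤ
open import Data.Bool using (Bool; true; false; if_then_else_; _∧_)
open import Data.List using (List; []; _∷_; map; length; filterᵇ; _++_; applyUpTo)
open import Data.List.Properties using (filter-++; length-++; map-upTo)
open import Function using (_∘_)
open import Relation.Nullary using (yes; no; contradiction)
open import Relation.Nullary.Decidable using (⌊_⌋)
open import Relation.Binary.PropositionalEquality
open ≡-Reasoning
open +-*-Solver

-- Shifting heights by a, a path counted by D^{k,a}_{n,m} becomes a walk on ℕ with steps +1 and
-- −(k−1) from a to km + a. Reversed and followed by a+1 steps −1, it becomes a walk with steps −1
-- and +(k−1) from km+a+1 that first reaches 0 after kn+a+1 steps; since a ≤ k−1 the appended
-- steps are forced, so this is a bijection. Splitting a first-passage walk from x at its first
-- step gives the recursion C_k^x = C_k^{x−1} + t C_k^{x−1+k} (that is, C_k = 1 + t C_k^k), so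
-- first-passage walks from x of length x + kj are counted by [t^j] C_k^x; the ballot theorem
-- matches the binomial coefficients defining C_k with the case x = 1. Finally the (n,m)-entry of
-- R(C_k^{a+1}, t C_k^k) is [t^{n−m}] C_k^{a+1+km}.

tailˢ : Series → Series
tailˢ f i = f (suc i)

infixl 7 _⋆_
infixr 8 _⋆^_

-- The Cauchy product _⊛_ in a form that is structurally recursive in the degree.
_⋆_ : Series → Series → Series
(f ⋆ g) zero    = f 0 * g 0
(f ⋆ g) (suc n) = f 0 * g (suc n) + (tailˢ f ⋆ g) n

_⋆^_ : Series → ℕ → Series
f ⋆^ zero  = one
f ⋆^ suc p = f ⋆ f ⋆^ p

sum-convolution : ∀ f g n → sum (applyUpTo (λ i → f i * g (n ∸ i)) (suc n)) ≡ (f ⋆ g) n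
sum-convolution f g zero    = +-identityʳ (f 0 * g 0)
sum-convolution f g (suc n) = cong (f 0 * g (suc n) +_) (sum-convolution (tailˢ f) g n)

⊛≗⋆ : ∀ f g → f ⊛ g ≗ f ⋆ g
⊛≗⋆ f g n = trans (cong sum (map-upTo _ (suc n))) (sum-convolution f g n)

⋆-cong-≤ : ∀ n {f f′ g g′} →
           (∀ i → i ≤ n → f i ≡ f′ i) → (∀ i → i ≤ n → g i ≡ g′ i) →
           (f ⋆ g) n ≡ (f′ ⋆ g′) n
⋆-cong-≤ zero    f≡ g≡ = cong₂ _*_ (f≡ 0 z≤n) (g≡ 0 z≤n)
⋆-cong-≤ (suc n) f≡ g≡ = cong₂ _+_ (cong₂ _*_ (f≡ 0 z≤n) (g≡ (suc n) ≤-refl))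
  (⋆-cong-≤ n (λ i i≤n → f≡ (suc i) (s≤s i≤n)) (λ i i≤n → g≡ i (m≤n⇒m≤1+n i≤n)))

⋆-cong : ∀ {f f′ g g′} → f ≗ f′ → g ≗ g′ → f ⋆ g ≗ f′ ⋆ g′
⋆-cong f≡ g≡ n = ⋆-cong-≤ n (λ i _ → f≡ i) (λ i _ → g≡ i)

⋆-congʳ : ∀ f {g g′} → g ≗ g′ → f ⋆ g ≗ f ⋆ g′
⋆-congʳ f = ⋆-cong (λ _ → refl)

⋆^-cong : ∀ {f f′} p → f ≗ f′ → f ⋆^ p ≗ f′ ⋆^ p
⋆^-cong zero    f≡ _ = refl
⋆^-cong (suc p) f≡   = ⋆-cong f≡ (⋆^-cong p f≡)

^ˢ≗⋆^ : ∀ f p → f ^ˢ p ≗ f ⋆^ p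
^ˢ≗⋆^ f zero    _ = refl
^ˢ≗⋆^ f (suc p) n = trans (⊛≗⋆ f (f ^ˢ p) n) (⋆-congʳ f (^ˢ≗⋆^ f p) n)

0ˢ-⋆ : ∀ g n → ((λ _ → 0) ⋆ g) n ≡ 0
0ˢ-⋆ g zero    = refl
0ˢ-⋆ g (suc n) = 0ˢ-⋆ g n

one-⋆ : ∀ g → one ⋆ g ≗ g
one-⋆ g zero    = +-identityʳ (g 0)
one-⋆ g (suc n) = begin
  1 * g (suc n) + ((λ _ → 0) ⋆ g) n ≡⟨ cong₂ _+_ (*-identityˡ (g (suc n))) (0ˢ-⋆ g n) ⟩
  g (suc n) + 0                     ≡⟨ +-identityʳ (g (suc n)) ⟩
  g (suc n)                         ∎

⋆-linearˡ : ∀ c f g h n → ((λ i → c * f i + g i) ⋆ h) n ≡ c * (f ⋆ h) n + (g ⋆ h) n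
⋆-linearˡ c f g h zero    = solve 4 (λ c f g h → (c :* f :+ g) :* h := c :* (f :* h) :+ g :* h)
                                    refl c (f 0) (g 0) (h 0)
⋆-linearˡ c f g h (suc n) = begin
  (c * f 0 + g 0) * h (suc n) + ((λ i → c * f (suc i) + g (suc i)) ⋆ h) n
    ≡⟨ cong ((c * f 0 + g 0) * h (suc n) +_) (⋆-linearˡ c (tailˢ f) (tailˢ g) h n) ⟩
  (c * f 0 + g 0) * h (suc n) + (c * (tailˢ f ⋆ h) n + (tailˢ g ⋆ h) n)
    ≡⟨ solve 6 (λ c f g h x y → (c :* f :+ g) :* h :+ (c :* x :+ y) := c :* (f :* h :+ x) :+ (g :* h :+ y))
             refl c (f 0) (g 0) (h (suc n)) ((tailˢ f ⋆ h) n) ((tailˢ g ⋆ h) n) ⟩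
  c * (f ⋆ h) (suc n) + (g ⋆ h) (suc n) ∎

⋆-assoc : ∀ f g h → (f ⋆ g) ⋆ h ≗ f ⋆ (g ⋆ h)
⋆-assoc f g h zero    = *-assoc (f 0) (g 0) (h 0)
⋆-assoc f g h (suc n) = begin
  (f 0 * g 0) * h (suc n) + (tailˢ (f ⋆ g) ⋆ h) n
    ≡⟨ cong ((f 0 * g 0) * h (suc n) +_) (⋆-linearˡ (f 0) (tailˢ g) (tailˢ f ⋆ g) h n) ⟩
  (f 0 * g 0) * h (suc n) + (f 0 * (tailˢ g ⋆ h) n + ((tailˢ f ⋆ g) ⋆ h) n)
    ≡⟨ cong (λ x → (f 0 * g 0) * h (suc n) + (f 0 * (tailˢ g ⋆ h) n + x)) (⋆-assoc (tailˢ f) g h n) ⟩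
  (f 0 * g 0) * h (suc n) + (f 0 * (tailˢ g ⋆ h) n + (tailˢ f ⋆ (g ⋆ h)) n)
    ≡⟨ solve 5 (λ f g h x y → f :* g :* h :+ (f :* x :+ y) := f :* (g :* h :+ x) :+ y)
             refl (f 0) (g 0) (h (suc n)) ((tailˢ g ⋆ h) n) ((tailˢ f ⋆ (g ⋆ h)) n) ⟩
  f 0 * (g ⋆ h) (suc n) + (tailˢ f ⋆ (g ⋆ h)) n ∎

⋆^-+ : ∀ f p q → f ⋆^ p ⋆ f ⋆^ q ≗ f ⋆^ (p + q)
⋆^-+ f zero    q = one-⋆ (f ⋆^ q)
⋆^-+ f (suc p) q n = trans (⋆-assoc f (f ⋆^ p) (f ⋆^ q) n) (⋆-congʳ f (⋆^-+ f p q) n)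

⋆^-* : ∀ f p q → (f ⋆^ p) ⋆^ q ≗ f ⋆^ (p * q)
⋆^-* f p zero    n rewrite *-zeroʳ p = refl
⋆^-* f p (suc q) n = begin
  (f ⋆^ p ⋆ (f ⋆^ p) ⋆^ q) n ≡⟨ ⋆-congʳ (f ⋆^ p) (⋆^-* f p q) n ⟩
  (f ⋆^ p ⋆ f ⋆^ (p * q)) n  ≡⟨ ⋆^-+ f p (p * q) n ⟩
  (f ⋆^ (p + p * q)) n       ≡⟨ cong (λ e → (f ⋆^ e) n) (sym (*-suc p q)) ⟩
  (f ⋆^ (p * suc q)) n       ∎

tmul-cong : ∀ {f g} → f ≗ g → tmul f ≗ tmul g
tmul-cong f≡ zero    = refl
tmul-cong f≡ (suc n) = f≡ n

tmul-⋆ : ∀ f g → tmul f ⋆ g ≗ tmul (f ⋆ g)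
tmul-⋆ f g zero    = refl
tmul-⋆ f g (suc n) = refl

⋆-tmul : ∀ f g → f ⋆ tmul g ≗ tmul (f ⋆ g)
⋆-tmul f g zero          = *-zeroʳ (f 0)
⋆-tmul f g (suc zero)    = trans (cong (f 0 * g 0 +_) (*-zeroʳ (f 1))) (+-identityʳ _)
⋆-tmul f g (suc (suc n)) = cong (f 0 * g (suc n) +_) (⋆-tmul (tailˢ f) g (suc n))

tmul^ : ℕ → Series → Series
tmul^ zero    f = f
tmul^ (suc m) f = tmul (tmul^ m f)

⋆-tmul^ : ∀ m f g → f ⋆ tmul^ m g ≗ tmul^ m (f ⋆ g)
⋆-tmul^ zero    f g n = refl
⋆-tmul^ (suc m) f g n = trans (⋆-tmul f (tmul^ m g) n) (tmul-cong (⋆-tmul^ m f g) n)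

tmul-⋆^ : ∀ f m → tmul f ⋆^ m ≗ tmul^ m (f ⋆^ m)
tmul-⋆^ f zero    n = refl
tmul-⋆^ f (suc m) n = begin
  (tmul f ⋆ tmul f ⋆^ m) n          ≡⟨ tmul-⋆ f (tmul f ⋆^ m) n ⟩
  tmul (f ⋆ tmul f ⋆^ m) n          ≡⟨ tmul-cong (⋆-congʳ f (tmul-⋆^ f m)) n ⟩
  tmul (f ⋆ tmul^ m (f ⋆^ m)) n     ≡⟨ tmul-cong (⋆-tmul^ m f (f ⋆^ m)) n ⟩
  tmul (tmul^ m (f ⋆ f ⋆^ m)) n     ∎

tmul^-coeff : ∀ m n f → m ≤ n → tmul^ m f n ≡ f (n ∸ m)
tmul^-coeff zero    n       f _         = refl
tmul^-coeff (suc m) (suc n) f (s≤s m≤n) = tmul^-coeff m n f m≤n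

riordan-powers : ∀ f b k m n → m ≤ n →
                 riordan (f ^ˢ b) (tmul (f ^ˢ k)) n m ≡ (f ⋆^ (b + k * m)) (n ∸ m)
riordan-powers f b k m n m≤n = begin
  ((f ^ˢ b) ⊛ (tmul (f ^ˢ k) ^ˢ m)) n
    ≡⟨ ⊛≗⋆ _ _ n ⟩
  (f ^ˢ b ⋆ tmul (f ^ˢ k) ^ˢ m) n
    ≡⟨ ⋆-cong (^ˢ≗⋆^ f b)
              (λ i → trans (^ˢ≗⋆^ _ m i) (⋆^-cong m (tmul-cong (^ˢ≗⋆^ f k)) i)) n ⟩
  (f ⋆^ b ⋆ tmul (f ⋆^ k) ⋆^ m) n
    ≡⟨ ⋆-congʳ (f ⋆^ b) (tmul-⋆^ (f ⋆^ k) m) n ⟩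
  (f ⋆^ b ⋆ tmul^ m ((f ⋆^ k) ⋆^ m)) n
    ≡⟨ ⋆-tmul^ m (f ⋆^ b) _ n ⟩
  tmul^ m (f ⋆^ b ⋆ (f ⋆^ k) ⋆^ m) n
    ≡⟨ tmul^-coeff m n _ m≤n ⟩
  (f ⋆^ b ⋆ (f ⋆^ k) ⋆^ m) (n ∸ m)
    ≡⟨ ⋆-congʳ (f ⋆^ b) (⋆^-* f k m) (n ∸ m) ⟩
  (f ⋆^ b ⋆ f ⋆^ (k * m)) (n ∸ m)
    ≡⟨ ⋆^-+ f b (k * m) (n ∸ m) ⟩
  (f ⋆^ (b + k * m)) (n ∸ m) ∎

kronecker : ℕ → ℕ → ℕ
kronecker zero    zero    = 1
kronecker zero    (suc _) = 0
kronecker (suc _) zero    = 0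
kronecker (suc m) (suc n) = kronecker m n

kronecker-sym : ∀ m n → kronecker m n ≡ kronecker n m
kronecker-sym zero    zero    = refl
kronecker-sym zero    (suc n) = refl
kronecker-sym (suc m) zero    = refl
kronecker-sym (suc m) (suc n) = kronecker-sym m n

kronecker-refl : ∀ n → kronecker n n ≡ 1
kronecker-refl zero    = refl
kronecker-refl (suc n) = kronecker-refl n

kronecker-≢ : ∀ {m n} → m ≢ n → kronecker m n ≡ 0
kronecker-≢ {zero}  {zero}  m≢n = contradiction refl m≢n
kronecker-≢ {zero}  {suc n} _   = refl
kronecker-≢ {suc m} {zero}  _   = refl
kronecker-≢ {suc m} {suc n} m≢n = kronecker-≢ (m≢n ∘ cong suc)

[1+k]*[1+n]C[1+k]≡[1+n]*nCk : ∀ n k → suc k * (suc n C suc k) ≡ suc n * (n C k)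
[1+k]*[1+n]C[1+k]≡[1+n]*nCk zero    zero    = refl
[1+k]*[1+n]C[1+k]≡[1+n]*nCk zero    (suc k) = *-zeroʳ (suc (suc k))
[1+k]*[1+n]C[1+k]≡[1+n]*nCk (suc n) zero    =
  trans (+-identityʳ _) (trans (nC1≡n (suc (suc n))) (sym (*-identityʳ (suc (suc n)))))
[1+k]*[1+n]C[1+k]≡[1+n]*nCk (suc n) (suc k) = begin
  suc (suc k) * (suc (suc n) C suc (suc k))
    ≡⟨ cong (suc (suc k) *_) (sym (nCk+nC[k+1]≡[n+1]C[k+1] (suc n) (suc k))) ⟩
  suc (suc k) * (suc n C suc k + suc n C suc (suc k))
    ≡⟨ solve 3 (λ k a b → (con 1 :+ k) :* (a :+ b) := a :+ k :* a :+ (con 1 :+ k) :* b)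
             refl (suc k) (suc n C suc k) (suc n C suc (suc k)) ⟩
  suc n C suc k + suc k * (suc n C suc k) + suc (suc k) * (suc n C suc (suc k))
    ≡⟨ cong₂ (λ u v → suc n C suc k + u + v)
             ([1+k]*[1+n]C[1+k]≡[1+n]*nCk n k) ([1+k]*[1+n]C[1+k]≡[1+n]*nCk n (suc k)) ⟩
  suc n C suc k + suc n * (n C k) + suc n * (n C suc k)
    ≡⟨ solve 4 (λ a n b c → a :+ n :* b :+ n :* c := a :+ n :* (b :+ c))
             refl (suc n C suc k) (suc n) (n C k) (n C suc k) ⟩
  suc n C suc k + suc n * (n C k + n C suc k)
    ≡⟨ cong (λ c → suc n C suc k + suc n * c) (nCk+nC[k+1]≡[n+1]C[k+1] n k) ⟩
  suc (suc n) * (suc n C suc k) ∎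

module KaryWalks (k₁ : ℕ) where

  k : ℕ
  k = suc k₁

  -- Walks of s steps −1 and +k₁ from x that reach 0 for the first time after the last step.
  firstPassage : ℕ → ℕ → ℕ
  firstPassage zero    zero    = 1
  firstPassage zero    (suc s) = 0
  firstPassage (suc x) zero    = 0
  firstPassage (suc x) (suc s) = firstPassage x s + firstPassage (suc x + k₁) s

  firstPassage-< : ∀ x s → s < x → firstPassage x s ≡ 0
  firstPassage-< (suc x) zero    _         = refl
  firstPassage-< (suc x) (suc s) (s≤s s<x) = cong₂ _+_ (firstPassage-< x s s<x)
    (firstPassage-< (suc x + k₁) s (≤-trans s<x (≤-trans (n≤1+n x) (m≤m+n (suc x) k₁))))

  firstPassage-diag : ∀ x → firstPassage x x ≡ 1
  firstPassage-diag zero    = refl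
  firstPassage-diag (suc x) =
    cong₂ _+_ (firstPassage-diag x) (firstPassage-< (suc x + k₁) x (s≤s (m≤m+n x k₁)))

  firstPassage-short : ∀ x s → s ≤ k → firstPassage x s ≡ kronecker x s
  firstPassage-short zero    zero    _         = refl
  firstPassage-short zero    (suc s) _         = refl
  firstPassage-short (suc x) zero    _         = refl
  firstPassage-short (suc x) (suc s) (s≤s s≤k₁) = trans
    (cong₂ _+_ (firstPassage-short x s (m≤n⇒m≤1+n s≤k₁))
               (firstPassage-< (suc x + k₁) s (s≤s (≤-trans s≤k₁ (m≤n+m k₁ x)))))
    (+-identityʳ _)

  -- The ballot number x/(N+1) · C(N+1, j+1), written without division.
  ballot : ∀ j x → let N = x + k * j + k₁ in
           firstPassage x (suc N) + k * (N C j) ≡ suc N C suc j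
  ballot j zero = *-cancelˡ-≡ _ _ (suc j) (begin
      suc j * (k * (N C j)) ≡⟨ solve 3 (λ a b c → a :* (b :* c) := (b :* a) :* c) refl (suc j) k (N C j) ⟩
      k * suc j * (N C j)   ≡⟨ cong (_* (N C j)) k[1+j]≡1+N ⟩
      suc N * (N C j)       ≡⟨ sym ([1+k]*[1+n]C[1+k]≡[1+n]*nCk N j) ⟩
      suc j * (suc N C suc j) ∎)
    where
    N : ℕ
    N = k * j + k₁
    k[1+j]≡1+N : k * suc j ≡ suc N
    k[1+j]≡1+N = trans (*-suc k j) (cong suc (+-comm k₁ (k * j)))
  ballot zero (suc x) = begin
      firstPassage x (suc N) + firstPassage (suc x + k₁) (suc N) + k * 1
        ≡⟨ cong (λ y → firstPassage x (suc N) + y + k * 1)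
                (trans (cong (firstPassage (suc x + k₁)) 1+N≡1+x+k₁) (firstPassage-diag (suc x + k₁))) ⟩
      firstPassage x (suc N) + 1 + k * 1
        ≡⟨ solve 2 (λ a b → a :+ con 1 :+ b := con 1 :+ (a :+ b)) refl (firstPassage x (suc N)) (k * 1) ⟩
      suc (firstPassage x (suc N) + k * 1)
        ≡⟨ cong suc (trans (ballot zero x) (nC1≡n (suc N))) ⟩
      suc (suc N)
        ≡⟨ sym (nC1≡n (suc (suc N))) ⟩
      suc (suc N) C 1 ∎
    where
    N : ℕ
    N = x + k * 0 + k₁
    1+N≡1+x+k₁ : suc N ≡ suc x + k₁
    1+N≡1+x+k₁ = cong (λ y → suc (y + k₁)) (trans (cong (x +_) (*-zeroʳ k)) (+-identityʳ x))
  ballot (suc j) (suc x) = begin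
      a + b + k * (suc N C suc j)
        ≡⟨ cong (λ c → a + b + k * c) (sym (nCk+nC[k+1]≡[n+1]C[k+1] N j)) ⟩
      a + b + k * (N C j + N C suc j)
        ≡⟨ solve 5 (λ a b k q p → a :+ b :+ k :* (q :+ p) := (b :+ k :* q) :+ (a :+ k :* p))
                 refl a b k (N C j) (N C suc j) ⟩
      (b + k * (N C j)) + (a + k * (N C suc j))
        ≡⟨ cong₂ _+_ ballot-up (ballot (suc j) x) ⟩
      suc N C suc j + suc N C suc (suc j)
        ≡⟨ nCk+nC[k+1]≡[n+1]C[k+1] (suc N) (suc j) ⟩
      suc (suc N) C suc (suc j) ∎
    where
    N a b : ℕ
    N = x + k * suc j + k₁
    a = firstPassage x (suc N)
    b = firstPassage (suc x + k₁) (suc N)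
    1+x+k₁+kj+k₁≡N : suc x + k₁ + k * j + k₁ ≡ N
    1+x+k₁+kj+k₁≡N = cong (_+ k₁) (begin
      suc x + k₁ + k * j ≡⟨ solve 3 (λ x k₁ y → con 1 :+ x :+ k₁ :+ y := x :+ (con 1 :+ k₁ :+ y))
                                    refl x k₁ (k * j) ⟩
      x + (k + k * j)    ≡⟨ cong (x +_) (sym (*-suc k j)) ⟩
      x + k * suc j      ∎)
    ballot-up : b + k * (N C j) ≡ suc N C suc j
    ballot-up = subst (λ M → firstPassage (suc x + k₁) (suc M) + k * (M C j) ≡ suc M C suc j)
                      1+x+k₁+kj+k₁≡N (ballot j (suc x + k₁))

  Ck-suc≡firstPassage : ∀ j → Ck k (suc j) ≡ firstPassage 1 (1 + k * suc j)
  Ck-suc≡firstPassage j = begin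
      (suc M C suc j) / suc M ≡⟨ cong (_/ suc M) (sym f*[1+M]≡X) ⟩
      (f * suc M) / suc M     ≡⟨ m*n/n≡m f (suc M) ⟩
      f                       ∎
    where
    M X f : ℕ
    M = k * suc j
    X = suc M C suc j
    f = firstPassage 1 (suc M)
    f+k*MCj≡X : f + k * (M C j) ≡ X
    f+k*MCj≡X = subst (λ N → firstPassage 1 (suc N) + k * (N C j) ≡ suc N C suc j)
                      (trans (cong suc (+-comm (k * j) k₁)) (sym (*-suc k j))) (ballot j 1)
    f*[1+M]≡X : f * suc M ≡ X
    f*[1+M]≡X = +-cancelʳ-≡ (M * X) _ _ (begin
       f * suc M + M * X              ≡⟨ cong (f * suc M +_) (trans (*-assoc k (suc j) X)
                                           (cong (k *_) ([1+k]*[1+n]C[1+k]≡[1+n]*nCk M j))) ⟩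
       f * suc M + k * (suc M * (M C j))
         ≡⟨ solve 4 (λ f s k c → f :* s :+ k :* (s :* c) := s :* (f :+ k :* c)) refl f (suc M) k (M C j) ⟩
       suc M * (f + k * (M C j))      ≡⟨ cong (suc M *_) f+k*MCj≡X ⟩
       X + M * X                      ∎)

  Ck-0 : Ck k 0 ≡ 1
  Ck-0 rewrite *-zeroʳ k = refl

  Ck-⋆^-0 : ∀ x → (Ck k ⋆^ x) 0 ≡ 1
  Ck-⋆^-0 zero    = refl
  Ck-⋆^-0 (suc x) = cong₂ _*_ Ck-0 (Ck-⋆^-0 x)

  Ck-⋆^ : ∀ j x → (Ck k ⋆^ x) j ≡ firstPassage x (x + k * j)
  Ck-⋆^ = <-rec P step
    where
    P : ℕ → Set
    P j = ∀ x → (Ck k ⋆^ x) j ≡ firstPassage x (x + k * j)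
    step : ∀ j → (∀ {i} → i < j → P i) → P j
    step zero    _  x       = begin
      (Ck k ⋆^ x) 0              ≡⟨ Ck-⋆^-0 x ⟩
      1                          ≡⟨ sym (firstPassage-diag x) ⟩
      firstPassage x x           ≡⟨ cong (firstPassage x) (sym (trans (cong (x +_) (*-zeroʳ k))
                                                                        (+-identityʳ x))) ⟩
      firstPassage x (x + k * 0) ∎
    step (suc j) IH zero    = refl
    step (suc j) IH (suc x) = begin
      Ck k 0 * (Ck k ⋆^ x) (suc j) + (tailˢ (Ck k) ⋆ Ck k ⋆^ x) j
        ≡⟨ cong₂ _+_ (cong₂ _*_ Ck-0 (step (suc j) IH x))
                     (⋆-cong-≤ j tail≡ (λ _ _ → refl)) ⟩
      1 * firstPassage x (x + k * suc j) + (Ck k ⋆^ k ⋆ Ck k ⋆^ x) j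
        ≡⟨ cong₂ _+_ (*-identityˡ _) (⋆^-+ (Ck k) k x j) ⟩
      firstPassage x (x + k * suc j) + (Ck k ⋆^ (k + x)) j
        ≡⟨ cong (firstPassage x (x + k * suc j) +_) (IH ≤-refl (k + x)) ⟩
      firstPassage x (x + k * suc j) + firstPassage (k + x) (k + x + k * j)
        ≡⟨ cong (firstPassage x (x + k * suc j) +_)
                (cong₂ firstPassage k+x≡1+x+k₁ (sym x+k[1+j]≡k+x+kj)) ⟩
      firstPassage (suc x) (suc x + k * suc j) ∎
      where
      k+x≡1+x+k₁ : k + x ≡ suc x + k₁
      k+x≡1+x+k₁ = cong suc (+-comm k₁ x)
      x+k[1+j]≡k+x+kj : x + k * suc j ≡ k + x + k * j
      x+k[1+j]≡k+x+kj = trans (cong (x +_) (*-suc k j))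
                        (solve 3 (λ x k y → x :+ (k :+ y) := k :+ x :+ y) refl x k (k * j))
      tail≡ : ∀ i → i ≤ j → Ck k (suc i) ≡ (Ck k ⋆^ k) i
      tail≡ i i≤j = trans (Ck-suc≡firstPassage i)
        (trans (cong (firstPassage 1) (cong suc (*-suc k i))) (sym (IH (s≤s i≤j) k)))

  downBy : ℕ → (ℕ → ℕ) → ℕ → ℕ
  downBy zero    f h       = f h
  downBy (suc c) f zero    = 0
  downBy (suc c) f (suc h) = downBy c f h

  downBy-cong : ∀ c {f g} → f ≗ g → downBy c f ≗ downBy c g
  downBy-cong zero    f≡ h       = f≡ h
  downBy-cong (suc c) f≡ zero    = refl
  downBy-cong (suc c) f≡ (suc h) = downBy-cong c f≡ h

  downBy-+ : ∀ c f g h → downBy c (λ i → f i + g i) h ≡ downBy c f h + downBy c g h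
  downBy-+ zero    f g h       = refl
  downBy-+ (suc c) f g zero    = refl
  downBy-+ (suc c) f g (suc h) = downBy-+ c f g h

  downBy-0 : ∀ c h → downBy c (λ _ → 0) h ≡ 0
  downBy-0 zero    h       = refl
  downBy-0 (suc c) zero    = refl
  downBy-0 (suc c) (suc h) = downBy-0 c h

  downBy-kronecker : ∀ c T h → downBy c (λ i → kronecker i T) h ≡ kronecker h (T + c)
  downBy-kronecker zero    T h       rewrite +-identityʳ T = refl
  downBy-kronecker (suc c) T zero    rewrite +-suc T c = refl
  downBy-kronecker (suc c) T (suc h) rewrite +-suc T c = downBy-kronecker c T h

  downBy-≥ : ∀ c f h → downBy c f (c + h) ≡ f h
  downBy-≥ zero    f h = refl
  downBy-≥ (suc c) f h = downBy-≥ c f h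

  downBy-< : ∀ c f h → h < c → downBy c f h ≡ 0
  downBy-< (suc c) f zero    _         = refl
  downBy-< (suc c) f (suc h) (s≤s h<c) = downBy-< c f h h<c

  -- Walks of L steps +1 and −k₁ from h to T that never go below 0.
  walksTo : ℕ → ℕ → ℕ → ℕ
  walksTo T zero    h = kronecker h T
  walksTo T (suc L) h = walksTo T L (suc h) + downBy k₁ (walksTo T L) h

  walksToPred : ℕ → ℕ → ℕ → ℕ
  walksToPred zero    L h = 0
  walksToPred (suc T) L h = walksTo T L h

  walksToPred-suc : ∀ T L h →
    walksToPred T (suc L) h ≡ walksToPred T L (suc h) + downBy k₁ (walksToPred T L) h
  walksToPred-suc zero    L h = sym (downBy-0 k₁ h)
  walksToPred-suc (suc T) L h = refl

  walksTo-suc-last : ∀ T L h → walksTo T (suc L) h ≡ walksToPred T L h + walksTo (T + k₁) L h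
  walksTo-suc-last zero    zero    h = cong (kronecker (suc h) 0 +_) (downBy-kronecker k₁ 0 h)
  walksTo-suc-last (suc T) zero    h = cong (kronecker h T +_) (downBy-kronecker k₁ (suc T) h)
  walksTo-suc-last T       (suc L) h = begin
    walksTo T (suc L) (suc h) + downBy k₁ (walksTo T (suc L)) h
      ≡⟨ cong₂ _+_ (walksTo-suc-last T L (suc h))
           (trans (downBy-cong k₁ (walksTo-suc-last T L) h) (downBy-+ k₁ p q h)) ⟩
    (p (suc h) + q (suc h)) + (downBy k₁ p h + downBy k₁ q h)
      ≡⟨ solve 4 (λ a b c d → (a :+ b) :+ (c :+ d) := (a :+ c) :+ (b :+ d))
               refl (p (suc h)) (q (suc h)) (downBy k₁ p h) (downBy k₁ q h) ⟩
    (p (suc h) + downBy k₁ p h) + (q (suc h) + downBy k₁ q h)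
      ≡⟨ cong (_+ (q (suc h) + downBy k₁ q h)) (sym (walksToPred-suc T L h)) ⟩
    walksToPred T (suc L) h + walksTo (T + k₁) (suc L) h ∎
    where
    p q : ℕ → ℕ
    p = walksToPred T L
    q = walksTo (T + k₁) L

  walksTo≡firstPassage : ∀ {a} → a ≤ k₁ → ∀ T L →
                         walksTo T L a ≡ firstPassage (suc T) (L + suc a)
  walksTo≡firstPassage {a} a≤k₁ T zero =
    trans (kronecker-sym a T) (sym (firstPassage-short (suc T) (suc a) (s≤s a≤k₁)))
  walksTo≡firstPassage {a} a≤k₁ T (suc L) =
    trans (walksTo-suc-last T L a) (cong₂ _+_ (pred≡ T) (walksTo≡firstPassage a≤k₁ (T + k₁) L))
    where
    pred≡ : ∀ T → walksToPred T L a ≡ firstPassage T (L + suc a)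
    pred≡ zero    rewrite +-suc L a = refl
    pred≡ (suc T) = walksTo≡firstPassage a≤k₁ T L

length-filterᵇ-++ : ∀ {A : Set} (p : A → Bool) xs ys →
  length (filterᵇ p (xs ++ ys)) ≡ length (filterᵇ p xs) + length (filterᵇ p ys)
length-filterᵇ-++ p xs ys = trans (cong length (filter-++ _ xs ys)) (length-++ (filterᵇ p xs))

length-filterᵇ-map : ∀ {A B : Set} (p : B → Bool) (f : A → B) xs →
  length (filterᵇ p (map f xs)) ≡ length (filterᵇ (p ∘ f) xs)
length-filterᵇ-map p f []       = refl
length-filterᵇ-map p f (x ∷ xs) with p (f x)
... | true  = cong suc (length-filterᵇ-map p f xs)
... | false = length-filterᵇ-map p f xs

length-filterᵇ-∧ : ∀ {A : Set} b (q : A → Bool) xs →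
  length (filterᵇ (λ x → b ∧ q x) xs) ≡ (if b then length (filterᵇ q xs) else 0)
length-filterᵇ-∧ true  q xs       = refl
length-filterᵇ-∧ false q []       = refl
length-filterᵇ-∧ false q (x ∷ xs) = length-filterᵇ-∧ false q xs

module LatticePaths where

  open import Data.Integer using (+_)

  module PathCount (k a : ℕ) (target : ℤ) where

    admissible : ℤ → Bool
    admissible y = ⌊ - (+ a) ℤ.≤? y ⌋

    count : ℕ → ℤ → ℕ
    count L y = length (filterᵇ (goodFrom k a y target) (allSeqs L))

    countIfAdmissible : ℕ → ℤ → ℕ
    countIfAdmissible L y = if admissible y then count L y else 0

    count-suc : ∀ L y → count (suc L) y ≡
      countIfAdmissible L (y ℤ.+ δ k U) + countIfAdmissible L (y ℤ.+ δ k Dn)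
    count-suc L y = begin
      length (filterᵇ good (map (U ∷_) paths ++ (map (Dn ∷_) paths ++ [])))
        ≡⟨ length-filterᵇ-++ good (map (U ∷_) paths) _ ⟩
      length (filterᵇ good (map (U ∷_) paths)) + length (filterᵇ good (map (Dn ∷_) paths ++ []))
        ≡⟨ cong₂ _+_ refl (trans (length-filterᵇ-++ good (map (Dn ∷_) paths) []) (+-identityʳ _)) ⟩
      length (filterᵇ good (map (U ∷_) paths)) + length (filterᵇ good (map (Dn ∷_) paths))
        ≡⟨ cong₂ _+_ (after U) (after Dn) ⟩
      countIfAdmissible L (y ℤ.+ δ k U) + countIfAdmissible L (y ℤ.+ δ k Dn) ∎
      where
      good : List Step → Bool
      good = goodFrom k a y target
      paths : List (List Step)
      paths = allSeqs L
      after : ∀ s → length (filterᵇ good (map (s ∷_) paths)) ≡ countIfAdmissible L (y ℤ.+ δ k s)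
      after s = trans (length-filterᵇ-map good (s ∷_) paths)
                      (length-filterᵇ-∧ (admissible y′) (goodFrom k a y′ target) paths)
        where
        y′ : ℤ
        y′ = y ℤ.+ δ k s

  ⊖≡+⇒≡+ : ∀ {h a c} → h ⊖ a ≡ + c → h ≡ c + a
  ⊖≡+⇒≡+ {h}     {zero}  {c} eq = trans (ℤ.+-injective eq) (sym (+-identityʳ c))
  ⊖≡+⇒≡+ {zero}  {suc a} ()
  ⊖≡+⇒≡+ {suc h} {suc a} {c} eq =
    trans (cong suc (⊖≡+⇒≡+ (trans (sym (ℤ.[1+m]⊖[1+n]≡m⊖n h a)) eq))) (sym (+-suc c a))

  [c+a]⊖a≡c : ∀ c a → (c + a) ⊖ a ≡ + c
  [c+a]⊖a≡c c a = trans (ℤ.⊖-≥ (m≤n+m a c)) (cong +_ (m+n∸n≡m c a))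

  ⊖-+-δU : ∀ k h a → (h ⊖ a) ℤ.+ δ k U ≡ suc h ⊖ a
  ⊖-+-δU k h a = trans (ℤ.distribˡ-⊖-+-pos 1 h a) (cong (_⊖ a) (+-comm h 1))

  ⊖-+-δDn : ∀ k₁ h a → (h ⊖ a) ℤ.+ δ (suc k₁) Dn ≡ h ⊖ (a + k₁)
  ⊖-+-δDn zero     h a = trans (ℤ.+-identityʳ (h ⊖ a)) (cong (h ⊖_) (sym (+-identityʳ a)))
  ⊖-+-δDn (suc k₂) h a = trans (ℤ.distribˡ-⊖-+-neg k₂ h a) (cong (h ⊖_) (sym (+-suc a k₂)))

  -- A height y ≥ −a is the integer h ⊖ a for a unique h : ℕ.
  module PathsAsWalks (k₁ a c : ℕ) where

    open KaryWalks k₁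
    open PathCount (suc k₁) a (+ c) public

    -a≤h⊖a : ∀ h → - (+ a) ℤ.≤ h ⊖ a
    -a≤h⊖a h = subst (ℤ._≤ h ⊖ a) (ℤ.⊖-≤ {0} {a} z≤n) (ℤ.⊖-monoˡ-≤ a z≤n)

    h⊖[a+k₁]<-a : ∀ {h} → h < k₁ → h ⊖ (a + k₁) ℤ.< - (+ a)
    h⊖[a+k₁]<-a {h} h<k₁ =
      subst (h ⊖ (a + k₁) ℤ.<_) k₁⊖[a+k₁]≡-a (ℤ.⊖-monoˡ-< (a + k₁) h<k₁)
      where
      k₁⊖[a+k₁]≡-a : k₁ ⊖ (a + k₁) ≡ - (+ a)
      k₁⊖[a+k₁]≡-a = begin
        k₁ ⊖ (a + k₁)       ≡⟨ cong₂ _⊖_ (sym (+-identityʳ k₁)) (+-comm a k₁) ⟩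
        (k₁ + 0) ⊖ (k₁ + a) ≡⟨ ℤ.+-cancelˡ-⊖ k₁ 0 a ⟩
        0 ⊖ a               ≡⟨ ℤ.⊖-≤ z≤n ⟩
        - (+ a)             ∎

    count-zero : ∀ h → count 0 (h ⊖ a) ≡ kronecker h (c + a)
    count-zero h with h ⊖ a ℤ.≟ + c
    ... | yes h⊖a≡c =
      sym (trans (cong (λ x → kronecker x (c + a)) (⊖≡+⇒≡+ h⊖a≡c)) (kronecker-refl (c + a)))
    ... | no  h⊖a≢c =
      sym (kronecker-≢ (λ h≡c+a → h⊖a≢c (trans (cong (_⊖ a) h≡c+a) ([c+a]⊖a≡c c a))))

    countIfAdmissible-⊖ : ∀ L h → countIfAdmissible L (h ⊖ a) ≡ count L (h ⊖ a)
    countIfAdmissible-⊖ L h with - (+ a) ℤ.≤? h ⊖ a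
    ... | yes _        = refl
    ... | no  -a≰h⊖a   = contradiction (-a≤h⊖a h) -a≰h⊖a

    countIfAdmissible-down : ∀ L h →
      countIfAdmissible L (h ⊖ (a + k₁)) ≡ downBy k₁ (λ h′ → count L (h′ ⊖ a)) h
    countIfAdmissible-down L h with k₁ ≤? h
    ... | yes k₁≤h = begin
      countIfAdmissible L (h ⊖ (a + k₁)) ≡⟨ cong (countIfAdmissible L) h⊖[a+k₁]≡h′⊖a ⟩
      countIfAdmissible L (h′ ⊖ a)       ≡⟨ countIfAdmissible-⊖ L h′ ⟩
      count L (h′ ⊖ a)                   ≡⟨ sym (downBy-≥ k₁ _ h′) ⟩
      downBy k₁ counts (k₁ + h′)         ≡⟨ cong (downBy k₁ counts) (m+[n∸m]≡n k₁≤h) ⟩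
      downBy k₁ counts h                 ∎
      where
      h′ : ℕ
      h′ = h ∸ k₁
      counts : ℕ → ℕ
      counts i = count L (i ⊖ a)
      h⊖[a+k₁]≡h′⊖a : h ⊖ (a + k₁) ≡ h′ ⊖ a
      h⊖[a+k₁]≡h′⊖a =
        trans (cong₂ _⊖_ (sym (m+[n∸m]≡n k₁≤h)) (+-comm a k₁)) (ℤ.+-cancelˡ-⊖ k₁ h′ a)
    ... | no  k₁≰h with - (+ a) ℤ.≤? h ⊖ (a + k₁)
    ...   | yes -a≤h⊖[a+k₁] =
      contradiction -a≤h⊖[a+k₁] (ℤ.<⇒≱ (h⊖[a+k₁]<-a (≰⇒> k₁≰h)))
    ...   | no  _           = sym (downBy-< k₁ _ h (≰⇒> k₁≰h))

    count≡walksTo : ∀ L h → count L (h ⊖ a) ≡ walksTo (c + a) L h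
    count≡walksTo zero    h = count-zero h
    count≡walksTo (suc L) h = begin
      count (suc L) (h ⊖ a)
        ≡⟨ count-suc L (h ⊖ a) ⟩
      countIfAdmissible L ((h ⊖ a) ℤ.+ δ (suc k₁) U) +
      countIfAdmissible L ((h ⊖ a) ℤ.+ δ (suc k₁) Dn)
        ≡⟨ cong₂ (λ y z → countIfAdmissible L y + countIfAdmissible L z)
                 (⊖-+-δU (suc k₁) h a) (⊖-+-δDn k₁ h a) ⟩
      countIfAdmissible L (suc h ⊖ a) + countIfAdmissible L (h ⊖ (a + k₁))
        ≡⟨ cong₂ _+_ (countIfAdmissible-⊖ L (suc h)) (countIfAdmissible-down L h) ⟩
      count L (suc h ⊖ a) + downBy k₁ (λ h′ → count L (h′ ⊖ a)) h
        ≡⟨ cong₂ _+_ (count≡walksTo L (suc h)) (downBy-cong k₁ (count≡walksTo L) h) ⟩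
      walksTo (c + a) L (suc h) + downBy k₁ (walksTo (c + a) L) h ∎

corollary3p3 : (k a : ℕ) → 2 ≤ k → a ≤ k ∸ 1 →
    (n m : ℕ) → m ≤ n →
    Dpaths k a n m ≡ riordan (Ck k ^ˢ (a + 1)) (tmul (Ck k ^ˢ k)) n m
corollary3p3 zero     a ()
corollary3p3 (suc k₁) a _ a≤k₁ n m m≤n = begin
  Dpaths k a n m
    ≡⟨ cong (count (k * n)) (sym (ℤ.n⊖n≡0 a)) ⟩
  count (k * n) (a ⊖ a)
    ≡⟨ count≡walksTo (k * n) a ⟩
  walksTo (k * m + a) (k * n) a
    ≡⟨ walksTo≡firstPassage a≤k₁ (k * m + a) (k * n) ⟩
  firstPassage (suc (k * m + a)) (k * n + suc a)
    ≡⟨ cong₂ firstPassage start≡x length≡x+k[n∸m] ⟩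
  firstPassage x (x + k * (n ∸ m))
    ≡⟨ sym (Ck-⋆^ (n ∸ m) x) ⟩
  (Ck k ⋆^ x) (n ∸ m)
    ≡⟨ sym (riordan-powers (Ck k) (a + 1) k m n m≤n) ⟩
  riordan (Ck k ^ˢ (a + 1)) (tmul (Ck k ^ˢ k)) n m ∎
  where
  open KaryWalks k₁
  open LatticePaths.PathsAsWalks k₁ a (k * m)
  x : ℕ
  x = a + 1 + k * m
  start≡x : suc (k * m + a) ≡ x
  start≡x = solve 2 (λ y a → con 1 :+ (y :+ a) := a :+ con 1 :+ y) refl (k * m) a
  length≡x+k[n∸m] : k * n + suc a ≡ x + k * (n ∸ m)
  length≡x+k[n∸m] = begin
    k * n + suc a                ≡⟨ cong (λ n → k * n + suc a) (sym (m+[n∸m]≡n m≤n)) ⟩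
    k * (m + (n ∸ m)) + suc a
      ≡⟨ solve 4 (λ k m d a → k :* (m :+ d) :+ (con 1 :+ a) := a :+ con 1 :+ k :* m :+ k :* d)
               refl k m (n ∸ m) a ⟩
    x + k * (n ∸ m)              ∎
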